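{- Let $(p,p')$ be positive integers with $|p-p'|=1$, $p_{\min}=\min\{p,p'\}$, and let $S=\alpha_{(p,p')}(S')$ be a Sturmian word, so that $a^{p_{\min}}b$ is the short block of $S$. If $X\in M_S$ and $|X|_b>0$, then $X=U\,b\,a^{p_{\min}}=a^{p_{\min}}\,b\,V$ for some words $U,V$.
   Context: Words are over the alphabet $\{a,b\}$. A Sturmian word is a right-infinite aperiodic word over $\{a,b\}$ of minimal factor complexity. For positive integers $p,p'$ with $|p-p'|=1$, $\alpha_{(p,p')}$ is the morphism $a\mapsto a^pb$, $b\mapsto a^{p'}b$; in $\alpha_{(p,p')}(S')$, the blocks $a^{p_{\min}}b$ and $a^{p_{\min}+1}b$ are called the short and long blocks. A palindrome is a word equal to its reverse. A palindrome $P$ is maximal in $S$ if $P$ has an occurrence $S=UPV$ such that $U[|U|]\,P\,V[1]$ is not a palindrome; $M_S$ is the set of distinct palindromes maximal in $S$. -}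

module Defs where

open import Data.Nat using (ℕ; zero; suc; _+_; _<_; _≤_)
open import Data.List using (List; []; _∷_; _++_; _∷ʳ_; length; reverse; map; concat; upTo)
open import Data.List.Membership.Propositional using (_∈_)
open import Data.List.Relation.Unary.Unique.Propositional using (Unique)
open import Data.Product using (Σ; ∃; _×_; _,_)
open import Data.Sum using (_⊎_)
open import Relation.Binary.PropositionalEquality using (_≡_)
open import Relation.Nullary using (¬_)
open import Function.Bundles using (_⇔_)

data Letter : Set where
  a b : Letter

Word : Set
Word = List Letter

InfWord : Set
InfWord = ℕ → Letter

factorAt : InfWord → ℕ → ℕ → Word
factorAt S i zero    = []
factorAt S i (suc n) = S i ∷ factorAt S (suc i) n

prefix : InfWord → ℕ → Word
prefix S n = factorAt S 0 n

IsFactor : InfWord → Word → Set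
IsFactor S w = ∃ λ i → factorAt S i (length w) ≡ w

HasComplexity : InfWord → ℕ → ℕ → Set
HasComplexity S n k =
  Σ (List Word) λ L → length L ≡ k × Unique L
    × (∀ w → (w ∈ L) ⇔ (length w ≡ n × IsFactor S w))

EventuallyPeriodic : InfWord → Set
EventuallyPeriodic S =
  Σ ℕ λ per → 0 < per × Σ ℕ λ N → ∀ n → N ≤ n → S (n + per) ≡ S n

Aperiodic : InfWord → Set
Aperiodic S = ¬ EventuallyPeriodic S

Sturmian : InfWord → Set
Sturmian S = Aperiodic S × (∀ n → HasComplexity S n (suc n))

pow-a : ℕ → Word
pow-a zero    = []
pow-a (suc n) = a ∷ pow-a n

α : ℕ → ℕ → Letter → Word
α p p' a = pow-a p ++ (b ∷ [])
α p p' b = pow-a p' ++ (b ∷ [])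

-- i-th letter of a finite word, with a default (never used below when the
-- index is in range).
lookupD : Word → ℕ → Letter
lookupD []       _       = a
lookupD (x ∷ w)  zero    = x
lookupD (x ∷ w)  (suc i) = lookupD w i

-- Image of an infinite word under a non-erasing morphism h:
-- its i-th letter is the i-th letter of h(S'[0..i]) (which has length ≥ i+1).
applyMorph : (Letter → Word) → InfWord → InfWord
applyMorph h S' i = lookupD (concat (map h (prefix S' (suc i)))) i

IsPalindrome : Word → Set
IsPalindrome w = reverse w ≡ w

-- P is maximal in S: it has an occurrence S = U P V with U nonempty
-- (U = S[0..j]) such that U[|U|] P V[1] = S[j] P S[j+1+|P|] is not a palindrome.
MaximalIn : InfWord → Word → Set
MaximalIn S P =
  IsPalindrome P ×
  Σ ℕ λ j → factorAt S (suc j) (length P) ≡ P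
          × ¬ IsPalindrome ((S j ∷ P) ∷ʳ S (suc j + length P))

count-b : Word → ℕ
count-b []      = 0
count-b (a ∷ w) = count-b w
count-b (b ∷ w) = suc (count-b w)

-- Cut S = α(S') into its blocks a^r b with r ∈ {q, q+1}, q = min(p, p').  Write a
-- palindrome X containing b as a^k b V; being a palindrome it also ends in b a^k.
-- A run of k a's flanked on one side by b determines the letter on its other side
-- unless k = q: if k < q the run lies inside a block, so the letter is a; if k = q+1
-- the run is a whole long block, so the letter is b; longer runs do not occur.  So
-- for k ≠ q the letters just before and just after the occurrence of X agree, and
-- X extends to a longer palindrome, against maximality.
module Submission where

open import Defs
open import Data.Nat using (ℕ; zero; suc; _+_; _∸_; _<_; _≤_; _⊓_; z≤n; s≤s; _≟_)
open import Data.Nat.Properties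
open import Data.Nat.Tactic.RingSolver using (solve-∀)
open import Data.List using ([]; _∷_; _++_; _∷ʳ_; length; reverse; map; concat)
open import Data.List.Properties
  using (map-++; concat-++; ++-identityʳ; ++-assoc; length-++; reverse-++; unfold-reverse; ∷-injective)
open import Data.Product using (Σ; ∃; ∃₂; _×_; _,_; proj₂; uncurry)
open import Data.Sum using (_⊎_; inj₁; inj₂)
open import Data.Empty using (⊥-elim)
open import Function using (_∘_)
open import Relation.Nullary using (¬_)
open import Relation.Nullary.Decidable using (decidable-stable)
open import Relation.Binary.Definitions using (tri<; tri≈; tri>)
open import Relation.Binary.PropositionalEquality

a≢b : a ≢ b
a≢b ()

length-pow-a : ∀ k → length (pow-a k) ≡ k
length-pow-a zero    = refl
length-pow-a (suc k) = cong suc (length-pow-a k)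

pow-a-∷ʳ-a : ∀ k → pow-a k ∷ʳ a ≡ a ∷ pow-a k
pow-a-∷ʳ-a zero    = refl
pow-a-∷ʳ-a (suc k) = cong (a ∷_) (pow-a-∷ʳ-a k)

reverse-pow-a : ∀ k → reverse (pow-a k) ≡ pow-a k
reverse-pow-a zero    = refl
reverse-pow-a (suc k) = begin
  reverse (a ∷ pow-a k)   ≡⟨ unfold-reverse a (pow-a k) ⟩
  reverse (pow-a k) ∷ʳ a  ≡⟨ cong (_∷ʳ a) (reverse-pow-a k) ⟩
  pow-a k ∷ʳ a            ≡⟨ pow-a-∷ʳ-a k ⟩
  a ∷ pow-a k             ∎
  where open ≡-Reasoning

reverse-pow-a-b : ∀ k V → reverse (pow-a k ++ b ∷ V) ≡ reverse V ++ b ∷ pow-a k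
reverse-pow-a-b k V = begin
  reverse (pow-a k ++ b ∷ V)               ≡⟨ reverse-++ (pow-a k) (b ∷ V) ⟩
  reverse (b ∷ V) ++ reverse (pow-a k)     ≡⟨ cong₂ _++_ (unfold-reverse b V) (reverse-pow-a k) ⟩
  (reverse V ∷ʳ b) ++ pow-a k              ≡⟨ ++-assoc (reverse V) (b ∷ []) (pow-a k) ⟩
  reverse V ++ b ∷ pow-a k                 ∎
  where open ≡-Reasoning

split-at-first-b : ∀ X → 0 < count-b X → ∃₂ λ k V → X ≡ pow-a k ++ b ∷ V
split-at-first-b (a ∷ X) b∈X with split-at-first-b X b∈X
... | k , V , refl = suc k , V , refl
split-at-first-b (b ∷ X) _ = 0 , X , refl

palindrome-wrap : ∀ {X c c'} → IsPalindrome X → c ≡ c' → IsPalindrome ((c ∷ X) ∷ʳ c')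
palindrome-wrap {X} {c} X-pal refl = begin
  reverse ((c ∷ X) ∷ʳ c)      ≡⟨ reverse-++ (c ∷ X) (c ∷ []) ⟩
  c ∷ reverse (c ∷ X)         ≡⟨ cong (c ∷_) (unfold-reverse c X) ⟩
  c ∷ (reverse X ∷ʳ c)        ≡⟨ cong (λ Y → c ∷ (Y ∷ʳ c)) X-pal ⟩
  (c ∷ X) ∷ʳ c                ∎
  where open ≡-Reasoning

lookupD-++ˡ : ∀ xs ys {i} → i < length xs → lookupD (xs ++ ys) i ≡ lookupD xs i
lookupD-++ˡ (x ∷ xs) ys {zero}  _         = refl
lookupD-++ˡ (x ∷ xs) ys {suc i} (s≤s i<n) = lookupD-++ˡ xs ys i<n

lookupD-++ʳ : ∀ xs ys t → lookupD (xs ++ ys) (length xs + t) ≡ lookupD ys t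
lookupD-++ʳ []       ys t = refl
lookupD-++ʳ (x ∷ xs) ys t = lookupD-++ʳ xs ys t

Occurs : InfWord → ℕ → Word → Set
Occurs S i w = factorAt S i (length w) ≡ w

Run : InfWord → ℕ → ℕ → Set
Run S i k = ∀ t → t < k → S (i + t) ≡ a

factorAt-∷ʳ : ∀ S i n → factorAt S i (suc n) ≡ factorAt S i n ∷ʳ S (i + n)
factorAt-∷ʳ S i zero    = cong (λ m → S m ∷ []) (sym (+-identityʳ i))
factorAt-∷ʳ S i (suc n) = cong (S i ∷_) (begin
  factorAt S (suc i) (suc n)                   ≡⟨ factorAt-∷ʳ S (suc i) n ⟩
  factorAt S (suc i) n ∷ʳ S (suc i + n)        ≡⟨ cong (λ m → factorAt S (suc i) n ∷ʳ S m) (+-suc i n) ⟨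
  factorAt S (suc i) n ∷ʳ S (i + suc n)        ∎)
  where open ≡-Reasoning

occurs-++ : ∀ {S i} u {w} → Occurs S i (u ++ w) → Occurs S i u × Occurs S (i + length u) w
occurs-++ {S} {i} [] {w} occ = refl , subst (λ m → Occurs S m w) (sym (+-identityʳ i)) occ
occurs-++ {S} {i} (x ∷ u) {w} occ with ∷-injective occ
... | refl , occ' with occurs-++ u occ'
... | occ-u , occ-w = cong (S i ∷_) occ-u , subst (λ m → Occurs S m w) (sym (+-suc i (length u))) occ-w

occurs-pow-a : ∀ {S i} k → Occurs S i (pow-a k) → Run S i k
occurs-pow-a {S} {i} (suc k) occ zero _ with ∷-injective occ
... | Si≡a , _ = subst (λ m → S m ≡ a) (sym (+-identityʳ i)) Si≡a
occurs-pow-a {S} {i} (suc k) occ (suc t) (s≤s t<k) =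
  subst (λ m → S m ≡ a) (sym (+-suc i t)) (occurs-pow-a k (proj₂ (∷-injective occ)) t t<k)

module MorphicImage (h : Letter → Word) (S' : InfWord) where

  image : ℕ → Word
  image n = concat (map h (prefix S' n))

  image-suc : ∀ n → image (suc n) ≡ image n ++ h (S' n)
  image-suc n = begin
    concat (map h (prefix S' (suc n)))              ≡⟨ cong (concat ∘ map h) (factorAt-∷ʳ S' 0 n) ⟩
    concat (map h (prefix S' n ∷ʳ S' n))            ≡⟨ cong concat (map-++ h (prefix S' n) (S' n ∷ [])) ⟩
    concat (map h (prefix S' n) ++ h (S' n) ∷ [])   ≡⟨ concat-++ (map h (prefix S' n)) (h (S' n) ∷ []) ⟨
    image n ++ h (S' n) ++ []                       ≡⟨ cong (image n ++_) (++-identityʳ (h (S' n))) ⟩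
    image n ++ h (S' n)                             ∎
    where open ≡-Reasoning

  length-image-suc : ∀ n → length (image (suc n)) ≡ length (image n) + length (h (S' n))
  length-image-suc n = trans (cong length (image-suc n)) (length-++ (image n))

  image-extends : ∀ d n → ∃ λ w → image (d + n) ≡ image n ++ w
  image-extends zero    n = [] , sym (++-identityʳ (image n))
  image-extends (suc d) n with image-extends d n
  ... | w , eq = w ++ h (S' (d + n)) , (begin
    image (suc d + n)                  ≡⟨ image-suc (d + n) ⟩
    image (d + n) ++ h (S' (d + n))    ≡⟨ cong (_++ h (S' (d + n))) eq ⟩
    (image n ++ w) ++ h (S' (d + n))   ≡⟨ ++-assoc (image n) w _ ⟩
    image n ++ w ++ h (S' (d + n))     ∎)
    where open ≡-Reasoning

  lookupD-image-mono : ∀ {n m i} → n ≤ m → i < length (image n) → lookupD (image m) i ≡ lookupD (image n) i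
  lookupD-image-mono {n} {m} {i} n≤m i<n with image-extends (m ∸ n) n
  ... | w , eq = begin
    lookupD (image m) i              ≡⟨ cong (λ l → lookupD (image l) i) (m∸n+n≡m n≤m) ⟨
    lookupD (image (m ∸ n + n)) i    ≡⟨ cong (λ v → lookupD v i) eq ⟩
    lookupD (image n ++ w) i         ≡⟨ lookupD-++ˡ (image n) w i<n ⟩
    lookupD (image n) i              ∎
    where open ≡-Reasoning

  module _ (nonErasing : ∀ x → 0 < length (h x)) where

    n≤length-image : ∀ n → n ≤ length (image n)
    n≤length-image zero    = z≤n
    n≤length-image (suc n) =
      ≤-trans (s≤s (n≤length-image n))
              (subst (suc (length (image n)) ≤_) (sym (length-image-suc n))
                     (m<m+n (length (image n)) (nonErasing (S' n))))

    applyMorph-lookupD : ∀ N {i} → i < length (image N) → applyMorph h S' i ≡ lookupD (image N) i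
    applyMorph-lookupD N {i} i<N with ≤-total (suc i) N
    ... | inj₁ i<N' = sym (lookupD-image-mono i<N' (n≤length-image (suc i)))
    ... | inj₂ N≤i  = lookupD-image-mono N≤i i<N

    applyMorph-block : ∀ n t → t < length (h (S' n)) →
                       applyMorph h S' (length (image n) + t) ≡ lookupD (h (S' n)) t
    applyMorph-block n t t<h = begin
      applyMorph h S' (length (image n) + t)                 ≡⟨ applyMorph-lookupD (suc n) in-block ⟩
      lookupD (image (suc n)) (length (image n) + t)          ≡⟨ cong (λ w → lookupD w (length (image n) + t)) (image-suc n) ⟩
      lookupD (image n ++ h (S' n)) (length (image n) + t)    ≡⟨ lookupD-++ʳ (image n) (h (S' n)) t ⟩
      lookupD (h (S' n)) t                                    ∎
      where
      open ≡-Reasoning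
      in-block : length (image n) + t < length (image (suc n))
      in-block = subst (length (image n) + t <_) (sym (length-image-suc n)) (+-monoʳ-< (length (image n)) t<h)

blockStart : (ℕ → ℕ) → ℕ → ℕ
blockStart r zero    = 0
blockStart r (suc n) = suc (blockStart r n + r n)

-- S = a^(r 0) b a^(r 1) b a^(r 2) b ⋯
record IsBlockWord (S : InfWord) (r : ℕ → ℕ) : Set where
  field
    block-a : ∀ n t → t < r n → S (blockStart r n + t) ≡ a
    block-b : ∀ n → S (blockStart r n + r n) ≡ b

-- c is the letter k steps away from the b that ends (or precedes) a block a^r b.
RunEdge : ℕ → ℕ → Letter → Set
RunEdge k r c = k ≤ r × (k < r → c ≡ a) × (k ≡ r → c ≡ b)

runEdge-short : ∀ {q k r c} → q ≤ r → RunEdge k r c → k < q → c ≡ a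
runEdge-short q≤r (_ , short , _) k<q = short (<-≤-trans k<q q≤r)

runEdge-long : ∀ {q k r c} → r ≤ suc q → RunEdge k r c → q < k → c ≡ b
runEdge-long r≤q+1 (k≤r , _ , exact) q<k = exact (≤-antisym k≤r (≤-trans r≤q+1 q<k))

runEdges-agree : ∀ {q k r r' c c'} → q ≤ r × r ≤ suc q → q ≤ r' × r' ≤ suc q →
                 RunEdge k r c → RunEdge k r' c' → k ≢ q → c ≡ c'
runEdges-agree {q} {k} (q≤r , r≤q+1) (q≤r' , r'≤q+1) edge edge' k≢q with <-cmp k q
... | tri< k<q _ _ = trans (runEdge-short q≤r edge k<q) (sym (runEdge-short q≤r' edge' k<q))
... | tri≈ _ k≡q _ = ⊥-elim (k≢q k≡q)
... | tri> _ _ q<k = trans (runEdge-long r≤q+1 edge q<k) (sym (runEdge-long r'≤q+1 edge' q<k))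

module BlockWord {S : InfWord} {r : ℕ → ℕ} (blocks : IsBlockWord S r) where
  open IsBlockWord blocks

  position-in-block : ∀ m → ∃₂ λ n t → m ≡ blockStart r n + t × t ≤ r n
  position-in-block zero = 0 , 0 , refl , z≤n
  position-in-block (suc m) with position-in-block m
  ... | n , t , refl , t≤r with m≤n⇒m<n∨m≡n t≤r
  ... | inj₁ t<r  = n , suc t , sym (+-suc _ t) , t<r
  ... | inj₂ refl = suc n , 0 , sym (+-identityʳ _) , z≤n

  b-ends-block : ∀ {m} → S m ≡ b → ∃ λ n → m ≡ blockStart r n + r n
  b-ends-block {m} Sm≡b with position-in-block m
  ... | n , t , refl , t≤r with m≤n⇒m<n∨m≡n t≤r
  ... | inj₁ t<r  = ⊥-elim (a≢b (trans (sym (block-a n t t<r)) Sm≡b))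
  ... | inj₂ refl = n , refl

  run-from-blockStart : ∀ n {k} → Run S (blockStart r n) k → RunEdge k (r n) (S (blockStart r n + k))
  run-from-blockStart n {k} run = ≮⇒≥ not-longer , block-a n k , exact
    where
    not-longer : ¬ r n < k
    not-longer r<k = a≢b (trans (sym (run (r n) r<k)) (block-b n))
    exact : k ≡ r n → S (blockStart r n + k) ≡ b
    exact k≡r = subst (λ t → S (blockStart r n + t) ≡ b) (sym k≡r) (block-b n)

  run-after-b : ∀ {e k} → S e ≡ b → Run S (suc e) k → ∃ λ n → RunEdge k (r n) (S (suc e + k))
  run-after-b Se≡b run with b-ends-block Se≡b
  ... | n , refl = suc n , run-from-blockStart (suc n) run

  run-before-b : ∀ {j k} → Run S (suc j) k → S (suc j + k) ≡ b → ∃ λ n → RunEdge k (r n) (S j)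
  run-before-b {j} {k} run b-after with b-ends-block b-after
  ... | n , end = n , ≮⇒≥ not-longer , shorter , exact
    where
    shuffle : ∀ x y z → x + (suc y + z) ≡ x + z + suc y
    shuffle = solve-∀

    shorter : k < r n → S j ≡ a
    shorter k<r with m≤n⇒∃[o]m+o≡n k<r
    ... | d , k+d≡r = subst (λ i → S i ≡ a) (sym j≡) (block-a n d d<r)
      where
      d<r : d < r n
      d<r = subst (d <_) k+d≡r (s≤s (m≤n+m d k))
      j≡ : j ≡ blockStart r n + d
      j≡ = +-cancelʳ-≡ (suc k) j _ (begin
        j + suc k                    ≡⟨ +-suc j k ⟩
        suc j + k                    ≡⟨ end ⟩
        blockStart r n + r n         ≡⟨ cong (blockStart r n +_) k+d≡r ⟨
        blockStart r n + (suc k + d) ≡⟨ shuffle (blockStart r n) k d ⟩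
        blockStart r n + d + suc k   ∎)
        where open ≡-Reasoning

    exact : k ≡ r n → S j ≡ b
    exact k≡r = b-before n (+-cancelʳ-≡ k (suc j) _ (trans end (cong (blockStart r n +_) (sym k≡r))))
      where
      b-before : ∀ n → suc j ≡ blockStart r n → S j ≡ b
      b-before zero    ()
      b-before (suc n) sj≡ = subst (λ i → S i ≡ b) (sym (suc-injective sj≡)) (block-b n)

    not-longer : ¬ r n < k
    not-longer r<k with m≤n⇒∃[o]m+o≡n r<k
    ... | d , r+d≡k = no-b-inside n (+-cancelʳ-≡ (r n) _ _ (begin
        blockStart r n + r n         ≡⟨ end ⟨
        suc j + k                    ≡⟨ cong (suc j +_) r+d≡k ⟨
        suc j + (suc (r n) + d)      ≡⟨ cong suc (shuffle j (r n) d) ⟩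
        suc (j + d + suc (r n))      ≡⟨ cong suc (+-suc (j + d) (r n)) ⟩
        suc (suc j + d) + r n        ∎))
      where
      open ≡-Reasoning
      d<k : d < k
      d<k = subst (d <_) r+d≡k (s≤s (m≤n+m d (r n)))
      no-b-inside : ∀ n → blockStart r n ≢ suc (suc j + d)
      no-b-inside zero    ()
      no-b-inside (suc n) eq =
        a≢b (trans (sym (run d d<k)) (trans (cong S (suc-injective (sym eq))) (block-b n)))

  runEdge-before : ∀ {j k} w → Occurs S (suc j) (pow-a k ++ b ∷ w) → ∃ λ n → RunEdge k (r n) (S j)
  runEdge-before {j} {k} w occ with occurs-++ (pow-a k) occ
  ... | occ-run , occ-b with ∷-injective occ-b
  ... | b-after , _ =
    run-before-b (occurs-pow-a k occ-run) (subst (λ t → S (suc j + t) ≡ b) (length-pow-a k) b-after)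

  runEdge-after : ∀ {i k} u → Occurs S i (u ++ b ∷ pow-a k) →
                  ∃ λ n → RunEdge k (r n) (S (i + length (u ++ b ∷ pow-a k)))
  runEdge-after {i} {k} u occ with occurs-++ u occ
  ... | _ , occ-b with ∷-injective occ-b
  ... | b-at , occ-run = subst (λ m → ∃ λ n → RunEdge k (r n) (S m)) (sym position)
                               (run-after-b b-at (occurs-pow-a k occ-run))
    where
    position : i + length (u ++ b ∷ pow-a k) ≡ suc (i + length u) + k
    position = begin
      i + length (u ++ b ∷ pow-a k)            ≡⟨ cong (i +_) (length-++ u) ⟩
      i + (length u + suc (length (pow-a k)))  ≡⟨ cong (λ l → i + (length u + suc l)) (length-pow-a k) ⟩
      i + (length u + suc k)                   ≡⟨ +-assoc i (length u) (suc k) ⟨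
      i + length u + suc k                     ≡⟨ +-suc (i + length u) k ⟩
      suc (i + length u) + k                   ∎
      where open ≡-Reasoning

runLength : ℕ → ℕ → Letter → ℕ
runLength p p' a = p
runLength p p' b = p'

runLength-bounds : ∀ {p p'} → p ≤ suc p' → p' ≤ suc p → ∀ x →
                   p ⊓ p' ≤ runLength p p' x × runLength p p' x ≤ suc (p ⊓ p')
runLength-bounds {p} {p'} p≤ p'≤ a = m⊓n≤m p p' , ⊓-glb (n≤1+n p) p≤
runLength-bounds {p} {p'} p≤ p'≤ b = m⊓n≤n p p' , ⊓-glb p'≤ (n≤1+n p')

adjacent⇒close : ∀ {p p'} → p' ≡ suc p ⊎ p ≡ suc p' → p ≤ suc p' × p' ≤ suc p
adjacent⇒close {p}     (inj₁ refl) = m≤n+m p 2 , ≤-refl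
adjacent⇒close {_} {p'} (inj₂ refl) = ≤-refl , m≤n+m p' 2

lookupD-pow-a-b-< : ∀ m t → t < m → lookupD (pow-a m ++ b ∷ []) t ≡ a
lookupD-pow-a-b-< (suc m) zero    _         = refl
lookupD-pow-a-b-< (suc m) (suc t) (s≤s t<m) = lookupD-pow-a-b-< m t t<m

lookupD-pow-a-b-≡ : ∀ m → lookupD (pow-a m ++ b ∷ []) m ≡ b
lookupD-pow-a-b-≡ zero    = refl
lookupD-pow-a-b-≡ (suc m) = lookupD-pow-a-b-≡ m

α-is-block : ∀ p p' x → α p p' x ≡ pow-a (runLength p p' x) ++ b ∷ []
α-is-block p p' a = refl
α-is-block p p' b = refl

length-α : ∀ p p' x → length (α p p' x) ≡ suc (runLength p p' x)
length-α p p' x = begin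
  length (α p p' x)                                   ≡⟨ cong length (α-is-block p p' x) ⟩
  length (pow-a (runLength p p' x) ++ b ∷ [])         ≡⟨ length-++ (pow-a (runLength p p' x)) ⟩
  length (pow-a (runLength p p' x)) + 1               ≡⟨ cong (_+ 1) (length-pow-a _) ⟩
  runLength p p' x + 1                                ≡⟨ +-comm _ 1 ⟩
  suc (runLength p p' x)                              ∎
  where open ≡-Reasoning

α-isBlockWord : ∀ p p' S' → IsBlockWord (applyMorph (α p p') S') (runLength p p' ∘ S')
α-isBlockWord p p' S' = record
  { block-a = λ n t t<r → trans (letter n t (<⇒≤ t<r))
                                (trans (cong (λ w → lookupD w t) (α-is-block p p' (S' n)))
                                       (lookupD-pow-a-b-< (r n) t t<r))
  ; block-b = λ n → trans (letter n (r n) ≤-refl)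
                          (trans (cong (λ w → lookupD w (r n)) (α-is-block p p' (S' n)))
                                 (lookupD-pow-a-b-≡ (r n)))
  }
  where
  open MorphicImage (α p p') S'
  r : ℕ → ℕ
  r = runLength p p' ∘ S'
  length-image : ∀ n → length (image n) ≡ blockStart r n
  length-image zero    = refl
  length-image (suc n) = begin
    length (image (suc n))                     ≡⟨ length-image-suc n ⟩
    length (image n) + length (α p p' (S' n))  ≡⟨ cong₂ _+_ (length-image n) (length-α p p' (S' n)) ⟩
    blockStart r n + suc (r n)                 ≡⟨ +-suc (blockStart r n) (r n) ⟩
    blockStart r (suc n)                       ∎
    where open ≡-Reasoning
  letter : ∀ n t → t ≤ r n → applyMorph (α p p') S' (blockStart r n + t) ≡ lookupD (α p p' (S' n)) t
  letter n t t≤r = subst (λ s → applyMorph (α p p') S' (s + t) ≡ lookupD (α p p' (S' n)) t)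
                         (length-image n)
                         (applyMorph-block nonErasing n t (subst (t <_) (sym (length-α p p' (S' n))) (s≤s t≤r)))
    where
    nonErasing : ∀ x → 0 < length (α p p' x)
    nonErasing x = subst (0 <_) (sym (length-α p p' x)) (s≤s z≤n)

mainTheorem7 : (p p' : ℕ) → 1 ≤ p → 1 ≤ p' → (p' ≡ suc p ⊎ p ≡ suc p') →
    (S' : InfWord) → Sturmian (applyMorph (α p p') S') →
    (X : Word) → MaximalIn (applyMorph (α p p') S') X → 0 < count-b X →
    Σ Word (λ U → X ≡ U ++ (b ∷ pow-a (p ⊓ p')))
    × Σ Word (λ V → X ≡ pow-a (p ⊓ p') ++ (b ∷ V))
mainTheorem7 p p' _ _ p≈p' S' _ X (X-pal , j , occ , not-pal) b∈X with split-at-first-b X b∈X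
... | k , V , refl = subst Shape k≡q ((reverse V , X≡reversed) , (V , refl))
  where
  open BlockWord (α-isBlockWord p p' S')
  q : ℕ
  q = p ⊓ p'
  S : InfWord
  S = applyMorph (α p p') S'
  Shape : ℕ → Set
  Shape m = Σ Word (λ U → pow-a k ++ b ∷ V ≡ U ++ b ∷ pow-a m)
          × Σ Word (λ W → pow-a k ++ b ∷ V ≡ pow-a m ++ b ∷ W)
  X≡reversed : pow-a k ++ b ∷ V ≡ reverse V ++ b ∷ pow-a k
  X≡reversed = trans (sym X-pal) (reverse-pow-a-b k V)
  bounds : ∀ x → q ≤ runLength p p' x × runLength p p' x ≤ suc q
  bounds = uncurry runLength-bounds (adjacent⇒close p≈p')
  flanks-agree : k ≢ q → S j ≡ S (suc j + length (pow-a k ++ b ∷ V))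
  flanks-agree k≢q with runEdge-before V occ
                      | runEdge-after (reverse V) (subst (Occurs S (suc j)) X≡reversed occ)
  ... | n , before | m , after =
    runEdges-agree (bounds (S' n)) (bounds (S' m)) before
      (subst (λ w → RunEdge k _ (S (suc j + length w))) (sym X≡reversed) after) k≢q
  k≡q : k ≡ q
  k≡q = decidable-stable (k ≟ q) (λ k≢q → not-pal (palindrome-wrap X-pal (flanks-agree k≢q)))
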